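{- Let $p,q$ be integers, $n\ge 0$ an integer, and $x$ a number with $x\neq -1$ and $1-3x+x^2\neq 0$. Then $$\begin{aligned}\sum_{k=0}^n x^kG_{p+k}H_{q+k}=&\frac{1}{1-3x+x^2}\big[x^{n+1}(xG_{p+n}H_{q+n}-G_{p+n+1}H_{q+n+1})+G_pH_q-xG_{p-1}H_{q-1}\big]\\&+\frac{x[(-1)^{n+1}x^{n+1}-1]}{(1+x)(1-3x+x^2)}\big(3G_pH_q-G_{p-1}H_{q-1}-G_{p+1}H_{q+1}\big).\end{aligned}$$
   Context: $(G_n)_{n\in\mathbb Z}$ and $(H_n)_{n\in\mathbb Z}$ are generalized Fibonacci sequences: $G_{n+2}=G_{n+1}+G_n$ and $H_{n+2}=H_{n+1}+H_n$ for all integers $n$, with arbitrary initial values $G_0,G_1$ and $H_0,H_1$. -}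

module Defs where

open import Level using (Level; _⊔_) renaming (suc to lsuc)
open import Data.Nat using (ℕ; zero; suc)
open import Data.Integer using (ℤ; +_) renaming (_+_ to _+ℤ_; _-_ to _-ℤ_)
open import Relation.Nullary using (¬_)
open import Algebra.Bundles using (CommutativeRing)

-- A field: a commutative ring with 0 ≠ 1 and a (total) inverse operation
-- which is a multiplicative inverse on every nonzero element.
-- (The value of 0⁻¹ is irrelevant/unspecified.)
record Field (c ℓ : Level) : Set (lsuc (c ⊔ ℓ)) where
  field
    commutativeRing : CommutativeRing c ℓ
  open CommutativeRing commutativeRing public
  field
    _⁻¹     : Carrier → Carrier
    0≉1     : ¬ (0# ≈ 1#)
    inverse : ∀ x → ¬ (x ≈ 0#) → x * (x ⁻¹) ≈ 1#

module FieldOps {c ℓ : Level} (F : Field c ℓ) where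
  open Field F

  pow : Carrier → ℕ → Carrier
  pow a zero    = 1#
  pow a (suc n) = a * pow a n

  sumTo : ℕ → (ℕ → Carrier) → Carrier
  sumTo zero    f = f 0
  sumTo (suc n) f = sumTo n f + f (suc n)

  3# : Carrier
  3# = 1# + 1# + 1#

  IsGenFib : (ℤ → Carrier) → Set ℓ
  IsGenFib G = ∀ (n : ℤ) → G (n +ℤ + 2) ≈ G (n +ℤ + 1) + G n

{-# OPTIONS --safe #-}
-- Products w r = G (p + r) * H (q + r) of two generalized Fibonacci sequences nearly satisfy the
-- recurrence w (r + 1) = 3 w r - w (r - 1): the defect 3 w r - w (r - 1) - w (r + 1) changes sign
-- from each r to the next. Multiplying the weighted sum Σ xᵏ w k by 1 - 3x + x² therefore
-- telescopes to boundary terms plus δ · Σ xᵏ⁺¹ (-1)ᵏ, with δ the defect at 0, and this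
-- alternating geometric sum is cleared by the factor 1 + x.
module Submission where

open import Defs
open import Level using (Level)
open import Data.Nat using (ℕ; zero; suc)
open import Data.Integer using (ℤ; +_) renaming (_+_ to _+ℤ_; _-_ to _-ℤ_)
open import Relation.Nullary using (¬_)
import Data.Nat as ℕ
import Data.Nat.Properties as ℕ
import Data.Integer as ℤ
import Data.Integer.Properties as ℤ
open import Data.Integer.Base using (-[1+_]; _⊖_; _◃_)
open import Data.Sign.Base as Sign using (Sign)
open import Data.Maybe.Base using (Maybe; map)
open import Algebra.Bundles using (CommutativeRing)
open import Algebra.Solver.Ring.AlmostCommutativeRing
  using (fromCommutativeRing; _-Raw-AlmostCommutative⟶_)
open import Relation.Binary.Consequences using (dec⇒weaklyDec)
import Relation.Binary.PropositionalEquality as ≡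
open ≡ using (_≡_)

-- Neither ready-made instantiation of the ring solver fits a general commutative ring:
-- natural coefficients have no negation, and the ring's own elements as coefficients
-- cannot recognise cancellation. Integer coefficients provide both.
module IntegerCoefficientSolver {c ℓ : Level} (R : CommutativeRing c ℓ) where
  open CommutativeRing R
  open import Algebra.Properties.Ring ring
    using (-0#≈0#; -‿involutive; -‿+-comm; -‿distribˡ-*; -‿distribʳ-*)
  open import Algebra.Properties.CommutativeSemigroup +-commutativeSemigroup
    using (interchange)
  open import Algebra.Properties.Semiring.Mult.TCOptimised semiring
    using (_×_; ×-homo-+; ×1-homo-*)
  open import Relation.Binary.Reasoning.Setoid setoid

  signed : Sign → Carrier → Carrier
  signed Sign.+ a = a
  signed Sign.- a = - a

  signed-cong : ∀ s {a b} → a ≈ b → signed s a ≈ signed s b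
  signed-cong Sign.+ a≈b = a≈b
  signed-cong Sign.- a≈b = -‿cong a≈b

  signed-* : ∀ s t a b → signed (s Sign.* t) (a * b) ≈ signed s a * signed t b
  signed-* Sign.+ Sign.+ a b = refl
  signed-* Sign.+ Sign.- a b = -‿distribʳ-* a b
  signed-* Sign.- Sign.+ a b = -‿distribˡ-* a b
  signed-* Sign.- Sign.- a b = begin
    a * b         ≈⟨ -‿involutive (a * b) ⟨
    - - (a * b)   ≈⟨ -‿cong (-‿distribʳ-* a b) ⟩
    - (a * - b)   ≈⟨ -‿distribˡ-* a (- b) ⟩
    - a * - b     ∎

  -- The optimised multiplication makes ⟦ + 3 ⟧ℤ reduce to 1# + 1# + 1#, i.e. to 3#.
  ⟦_⟧ℤ : ℤ → Carrier
  ⟦ i ⟧ℤ = signed (ℤ.sign i) (ℤ.∣ i ∣ × 1#)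

  ⟦◃⟧ : ∀ s n → ⟦ s ◃ n ⟧ℤ ≈ signed s (n × 1#)
  ⟦◃⟧ Sign.+ zero    = refl
  ⟦◃⟧ Sign.- zero    = sym -0#≈0#
  ⟦◃⟧ Sign.+ (suc n) = refl
  ⟦◃⟧ Sign.- (suc n) = refl

  1+a-[1+b]≈a-b : ∀ a b → (1# + a) - (1# + b) ≈ a - b
  1+a-[1+b]≈a-b a b = begin
    (1# + a) - (1# + b)     ≈⟨ +-congˡ (-‿+-comm 1# b) ⟨
    (1# + a) + (- 1# + - b) ≈⟨ interchange 1# a (- 1#) (- b) ⟩
    (1# - 1#) + (a - b)     ≈⟨ +-congʳ (-‿inverseʳ 1#) ⟩
    0# + (a - b)            ≈⟨ +-identityˡ (a - b) ⟩
    a - b                   ∎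

  ⟦⊖⟧ : ∀ m n → ⟦ m ⊖ n ⟧ℤ ≈ m × 1# - n × 1#
  ⟦⊖⟧ zero    zero    = sym (-‿inverseʳ 0#)
  ⟦⊖⟧ zero    (suc n) = sym (+-identityˡ _)
  ⟦⊖⟧ (suc m) zero    = sym (trans (+-congˡ -0#≈0#) (+-identityʳ _))
  ⟦⊖⟧ (suc m) (suc n) = begin
    ⟦ suc m ⊖ suc n ⟧ℤ          ≡⟨ ≡.cong ⟦_⟧ℤ (ℤ.[1+m]⊖[1+n]≡m⊖n m n) ⟩
    ⟦ m ⊖ n ⟧ℤ                  ≈⟨ ⟦⊖⟧ m n ⟩
    m × 1# - n × 1#             ≈⟨ 1+a-[1+b]≈a-b _ _ ⟨
    (1# + m × 1#) - (1# + n × 1#) ≈⟨ +-cong (×-homo-+ 1# 1 m) (-‿cong (×-homo-+ 1# 1 n)) ⟨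
    suc m × 1# - suc n × 1#     ∎

  ⟦+⟧ : ∀ i j → ⟦ i ℤ.+ j ⟧ℤ ≈ ⟦ i ⟧ℤ + ⟦ j ⟧ℤ
  ⟦+⟧ (+ m)    (+ n)    = ×-homo-+ 1# m n
  ⟦+⟧ (+ m)    -[1+ n ] = ⟦⊖⟧ m (suc n)
  ⟦+⟧ -[1+ m ] (+ n)    = trans (⟦⊖⟧ n (suc m)) (+-comm _ _)
  ⟦+⟧ -[1+ m ] -[1+ n ] = begin
    - (suc (suc (m ℕ.+ n)) × 1#)  ≡⟨ ≡.cong (λ k → - (k × 1#)) (ℕ.+-suc (suc m) n) ⟨
    - ((suc m ℕ.+ suc n) × 1#)    ≈⟨ -‿cong (×-homo-+ 1# (suc m) (suc n)) ⟩
    - (suc m × 1# + suc n × 1#)   ≈⟨ -‿+-comm _ _ ⟨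
    - (suc m × 1#) - suc n × 1#   ∎

  ⟦*⟧ : ∀ i j → ⟦ i ℤ.* j ⟧ℤ ≈ ⟦ i ⟧ℤ * ⟦ j ⟧ℤ
  ⟦*⟧ i j = begin
    ⟦ s ◃ (ℤ.∣ i ∣ ℕ.* ℤ.∣ j ∣) ⟧ℤ          ≈⟨ ⟦◃⟧ s (ℤ.∣ i ∣ ℕ.* ℤ.∣ j ∣) ⟩
    signed s ((ℤ.∣ i ∣ ℕ.* ℤ.∣ j ∣) × 1#)    ≈⟨ signed-cong s (×1-homo-* ℤ.∣ i ∣ ℤ.∣ j ∣) ⟩
    signed s ((ℤ.∣ i ∣ × 1#) * (ℤ.∣ j ∣ × 1#)) ≈⟨ signed-* (ℤ.sign i) (ℤ.sign j) _ _ ⟩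
    ⟦ i ⟧ℤ * ⟦ j ⟧ℤ                          ∎
    where
    s : Sign
    s = ℤ.sign i Sign.* ℤ.sign j

  ⟦-⟧ : ∀ i → ⟦ ℤ.- i ⟧ℤ ≈ - ⟦ i ⟧ℤ
  ⟦-⟧ (+ zero)  = sym -0#≈0#
  ⟦-⟧ (+ suc n) = refl
  ⟦-⟧ -[1+ n ]  = sym (-‿involutive _)

  ℤ-homomorphism : ℤ.+-*-rawRing -Raw-AlmostCommutative⟶ fromCommutativeRing R
  ℤ-homomorphism = record
    { ⟦_⟧    = ⟦_⟧ℤ
    ; +-homo = ⟦+⟧
    ; *-homo = ⟦*⟧
    ; -‿homo = ⟦-⟧
    ; 0-homo = refl
    ; 1-homo = refl
    }

  ⟦⟧-weaklyDecidable : ∀ i j → Maybe (⟦ i ⟧ℤ ≈ ⟦ j ⟧ℤ)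
  ⟦⟧-weaklyDecidable i j = map (λ { ≡.refl → refl }) (dec⇒weaklyDec ℤ._≟_ i j)

  open import Algebra.Solver.Ring ℤ.+-*-rawRing (fromCommutativeRing R) ℤ-homomorphism
    ⟦⟧-weaklyDecidable public

module FieldProperties {f ℓ : Level} (F : Field f ℓ) where
  open Field F
  open IntegerCoefficientSolver commutativeRing using (solve; _:=_; _:+_; _:*_)
  open import Algebra.Properties.Ring ring using (+-inverseʳ-unique)
  open import Relation.Binary.Reasoning.Setoid setoid

  inverseˡ : ∀ x → ¬ (x ≈ 0#) → x ⁻¹ * x ≈ 1#
  inverseˡ x x≉0 = trans (*-comm (x ⁻¹) x) (inverse x x≉0)

  x*y≉0 : ∀ {x y} → ¬ (x ≈ 0#) → ¬ (y ≈ 0#) → ¬ (x * y ≈ 0#)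
  x*y≉0 {x} {y} x≉0 y≉0 xy≈0 = x≉0 (begin
    x                ≈⟨ *-identityʳ x ⟨
    x * 1#           ≈⟨ *-congˡ (inverse y y≉0) ⟨
    x * (y * y ⁻¹)   ≈⟨ *-assoc x y (y ⁻¹) ⟨
    (x * y) * y ⁻¹   ≈⟨ *-congʳ xy≈0 ⟩
    0# * y ⁻¹        ≈⟨ zeroˡ (y ⁻¹) ⟩
    0#               ∎)

  *-cancelˡ : ∀ {x a b} → ¬ (x ≈ 0#) → x * a ≈ x * b → a ≈ b
  *-cancelˡ {x} {a} {b} x≉0 xa≈xb = begin
    a                ≈⟨ *-identityˡ a ⟨
    1# * a           ≈⟨ *-congʳ (inverseˡ x x≉0) ⟨
    (x ⁻¹ * x) * a   ≈⟨ *-assoc (x ⁻¹) x a ⟩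
    x ⁻¹ * (x * a)   ≈⟨ *-congˡ xa≈xb ⟩
    x ⁻¹ * (x * b)   ≈⟨ *-assoc (x ⁻¹) x b ⟨
    (x ⁻¹ * x) * b   ≈⟨ *-congʳ (inverseˡ x x≉0) ⟩
    1# * b           ≈⟨ *-identityˡ b ⟩
    b                ∎

  1+x≉0 : ∀ {x} → ¬ (x ≈ - 1#) → ¬ (1# + x ≈ 0#)
  1+x≉0 {x} x≉-1 1+x≈0 = x≉-1 (+-inverseʳ-unique 1# x 1+x≈0)

  partialFractions : ∀ {u d s a b c} → ¬ (u ≈ 0#) → ¬ (d ≈ 0#) →
    (u * d) * s ≈ u * a + b * c → s ≈ d ⁻¹ * a + b * (u * d) ⁻¹ * c
  partialFractions {u} {d} {s} {a} {b} {c} u≉0 d≉0 uds≈ = *-cancelˡ ud≉0 (begin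
    (u * d) * s                                   ≈⟨ uds≈ ⟩
    u * a + b * c                                 ≈⟨ +-cong (*-identityʳ _) (*-identityʳ _) ⟨
    u * a * 1# + b * c * 1#                       ≈⟨ +-cong (*-congˡ (inverse d d≉0)) (*-congˡ (inverse (u * d) ud≉0)) ⟨
    u * a * (d * d ⁻¹) + b * c * ((u * d) * (u * d) ⁻¹)
      ≈⟨ solve 7 (λ u d i j a b c →
           u :* a :* (d :* i) :+ b :* c :* ((u :* d) :* j) := (u :* d) :* (i :* a :+ b :* j :* c))
           refl u d (d ⁻¹) ((u * d) ⁻¹) a b c ⟩
    (u * d) * (d ⁻¹ * a + b * (u * d) ⁻¹ * c)     ∎)
    where
    ud≉0 : ¬ (u * d ≈ 0#)
    ud≉0 = x*y≉0 u≉0 d≉0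

module FibonacciSums {f ℓ : Level} (F : Field f ℓ) where
  open Field F hiding (zero)
  open FieldOps F
  open IntegerCoefficientSolver commutativeRing
  open import Algebra.Properties.Ring ring using (-1*x≈-x; -‿distribˡ-*; x[y-z]≈xy-xz)
  open import Relation.Binary.Reasoning.Setoid setoid

  -- x² χ(1/x) for χ(t) = t² - 3t + 1, whose roots φ², ψ² are the squares of those of t² - t - 1.
  charPoly : Carrier → Carrier
  charPoly x = 1# - 3# * x + x * x

  sumTo-cong : ∀ n {f g : ℕ → Carrier} → (∀ k → f k ≈ g k) → sumTo n f ≈ sumTo n g
  sumTo-cong zero    f≈g = f≈g 0
  sumTo-cong (suc n) f≈g = +-cong (sumTo-cong n f≈g) (f≈g (suc n))

  defect : (ℤ → Carrier) → ℤ → Carrier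
  defect w r = 3# * w r - w (ℤ.pred r) - w (ℤ.suc r)

  weightedSum-telescope : ∀ (w : ℤ → Carrier) x n →
    charPoly x * sumTo n (λ k → pow x k * w (+ k))
      ≈ pow x (suc n) * (x * w (+ n) - w (+ suc n)) + w (+ 0) - x * w -[1+ 0 ]
        - sumTo n (λ k → pow x (suc k) * defect w (+ k))
  weightedSum-telescope w x zero =
    solve 4 (λ x u v t →
      ((con (+ 1) :- con (+ 3) :* x) :+ x :* x) :* (con (+ 1) :* v)
      := (x :* con (+ 1)) :* (x :* v :- t) :+ v :- x :* u
         :- (x :* con (+ 1)) :* (con (+ 3) :* v :- u :- t))
      refl x (w -[1+ 0 ]) (w (+ 0)) (w (+ 1))
  weightedSum-telescope w x (suc n) = begin
    charPoly x * (sumTo n (λ k → pow x k * w (+ k)) + y * w (+ suc n))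
      ≈⟨ distribˡ (charPoly x) _ _ ⟩
    charPoly x * sumTo n (λ k → pow x k * w (+ k)) + charPoly x * (y * w (+ suc n))
      ≈⟨ +-congʳ (weightedSum-telescope w x n) ⟩
    y * (x * w (+ n) - w (+ suc n)) + w (+ 0) - x * w -[1+ 0 ] - Σ + charPoly x * (y * w (+ suc n))
      ≈⟨ solve 8 (λ x y u v a b d Σ →
           y :* (x :* a :- b) :+ v :- x :* u :- Σ
             :+ ((con (+ 1) :- con (+ 3) :* x) :+ x :* x) :* (y :* b)
           := (x :* y) :* (x :* b :- d) :+ v :- x :* u
             :- (Σ :+ (x :* y) :* (con (+ 3) :* b :- a :- d)))
           refl x y (w -[1+ 0 ]) (w (+ 0)) (w (+ n)) (w (+ suc n)) (w (+ suc (suc n))) Σ ⟩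
    x * y * (x * w (+ suc n) - w (+ suc (suc n))) + w (+ 0) - x * w -[1+ 0 ]
      - (Σ + x * y * defect w (+ suc n)) ∎
    where
    y Σ : Carrier
    y = pow x (suc n)
    Σ = sumTo n (λ k → pow x (suc k) * defect w (+ k))

  genFib-suc : ∀ {g : ℤ → Carrier} → IsGenFib g → ∀ r → g (ℤ.suc r) ≈ g r + g (ℤ.pred r)
  genFib-suc {g} fib r = begin
    g (ℤ.suc r)                       ≡⟨ ≡.cong g pred+2≡suc ⟨
    g (ℤ.pred r +ℤ + 2)               ≈⟨ fib (ℤ.pred r) ⟩
    g (ℤ.pred r +ℤ + 1) + g (ℤ.pred r) ≡⟨ ≡.cong (λ i → g i + g (ℤ.pred r)) pred+1≡id ⟩
    g r + g (ℤ.pred r)                ∎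
    where
    pred+1≡id : ℤ.pred r +ℤ + 1 ≡ r
    pred+1≡id = ≡.trans (ℤ.+-comm (ℤ.pred r) (+ 1)) (ℤ.suc-pred r)
    pred+2≡suc : ℤ.pred r +ℤ + 2 ≡ ℤ.suc r
    pred+2≡suc = ≡.trans (ℤ.+-comm (ℤ.pred r) (+ 2))
                   (≡.trans (ℤ.+-assoc (+ 1) (+ 1) (ℤ.pred r)) (≡.cong ℤ.suc (ℤ.suc-pred r)))

  defect-product-suc : ∀ {g h : ℤ → Carrier} → IsGenFib g → IsGenFib h → ∀ r →
    defect (λ i → g i * h i) (ℤ.suc r) ≈ - defect (λ i → g i * h i) r
  defect-product-suc {g} {h} fibg fibh r = begin
    defect (λ i → g i * h i) (ℤ.suc r)
      ≈⟨ +-cong (+-cong (*-congˡ (*-cong g₁ h₁)) (-‿cong (*-cong g₀ h₀))) (-‿cong (*-cong g₂ h₂)) ⟩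
    3# * ((b + a) * (d + c)) - b * d - ((b + a) + b) * ((d + c) + d)
      ≈⟨ solve 4 (λ a b c d →
           con (+ 3) :* ((b :+ a) :* (d :+ c)) :- b :* d :- ((b :+ a) :+ b) :* ((d :+ c) :+ d)
           := :- (con (+ 3) :* (b :* d) :- a :* c :- (b :+ a) :* (d :+ c)))
           refl a b c d ⟩
    - (3# * (b * d) - a * c - (b + a) * (d + c))
      ≈⟨ -‿cong (+-congˡ (-‿cong (*-cong (genFib-suc fibg r) (genFib-suc fibh r)))) ⟨
    - defect (λ i → g i * h i) r ∎
    where
    a b c d : Carrier
    a = g (ℤ.pred r)
    b = g r
    c = h (ℤ.pred r)
    d = h r
    g₀ : g (ℤ.pred (ℤ.suc r)) ≈ b
    g₀ = reflexive (≡.cong g (ℤ.pred-suc r))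
    h₀ : h (ℤ.pred (ℤ.suc r)) ≈ d
    h₀ = reflexive (≡.cong h (ℤ.pred-suc r))
    g₁ : g (ℤ.suc r) ≈ b + a
    g₁ = genFib-suc fibg r
    h₁ : h (ℤ.suc r) ≈ d + c
    h₁ = genFib-suc fibh r
    g₂ : g (ℤ.suc (ℤ.suc r)) ≈ (b + a) + b
    g₂ = trans (genFib-suc fibg (ℤ.suc r)) (+-cong g₁ g₀)
    h₂ : h (ℤ.suc (ℤ.suc r)) ≈ (d + c) + d
    h₂ = trans (genFib-suc fibh (ℤ.suc r)) (+-cong h₁ h₀)

  defect-product-alternates : ∀ {g h : ℤ → Carrier} → IsGenFib g → IsGenFib h → ∀ k →
    defect (λ i → g i * h i) (+ k) ≈ pow (- 1#) k * defect (λ i → g i * h i) (+ 0)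
  defect-product-alternates fibg fibh zero = sym (*-identityˡ _)
  defect-product-alternates {g} {h} fibg fibh (suc k) = begin
    defect w (ℤ.suc (+ k))     ≈⟨ defect-product-suc fibg fibh (+ k) ⟩
    - defect w (+ k)           ≈⟨ -‿cong (defect-product-alternates fibg fibh k) ⟩
    - (pow (- 1#) k * δ)       ≈⟨ -‿distribˡ-* _ δ ⟩
    - pow (- 1#) k * δ         ≈⟨ *-congʳ (-1*x≈-x _) ⟨
    pow (- 1#) (suc k) * δ     ∎
    where
    w : ℤ → Carrier
    w i = g i * h i
    δ : Carrier
    δ = defect w (+ 0)

  alternatingGeometricSum : ∀ x t n →
    (1# + x) * sumTo n (λ k → pow x (suc k) * (pow (- 1#) k * t))
      ≈ x * (1# - pow (- 1#) (suc n) * pow x (suc n)) * t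
  alternatingGeometricSum x t zero =
    solve 2 (λ x t →
      (con (+ 1) :+ x) :* ((x :* con (+ 1)) :* (con (+ 1) :* t))
      := x :* (con (+ 1) :- (:- con (+ 1) :* con (+ 1)) :* (x :* con (+ 1))) :* t)
      refl x t
  alternatingGeometricSum x t (suc n) = begin
    (1# + x) * (Σ + x * y * (s * t))       ≈⟨ distribˡ (1# + x) Σ _ ⟩
    (1# + x) * Σ + (1# + x) * (x * y * (s * t)) ≈⟨ +-congʳ (alternatingGeometricSum x t n) ⟩
    x * (1# - s * y) * t + (1# + x) * (x * y * (s * t))
      ≈⟨ solve 4 (λ x y s t →
           x :* (con (+ 1) :- s :* y) :* t :+ (con (+ 1) :+ x) :* (x :* y :* (s :* t))
           := x :* (con (+ 1) :- (:- con (+ 1) :* s) :* (x :* y)) :* t)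
           refl x y s t ⟩
    x * (1# - - 1# * s * (x * y)) * t      ∎
    where
    y s Σ : Carrier
    y = pow x (suc n)
    s = pow (- 1#) (suc n)
    Σ = sumTo n (λ k → pow x (suc k) * (pow (- 1#) k * t))

  genFib-shift : ∀ {g : ℤ → Carrier} → IsGenFib g → ∀ p → IsGenFib (λ r → g (p +ℤ r))
  genFib-shift {g} fib p n = begin
    g (p +ℤ (n +ℤ + 2))          ≡⟨ ≡.cong g (ℤ.+-assoc p n (+ 2)) ⟨
    g (p +ℤ n +ℤ + 2)            ≈⟨ fib (p +ℤ n) ⟩
    g (p +ℤ n +ℤ + 1) + g (p +ℤ n) ≡⟨ ≡.cong (λ i → g i + g (p +ℤ n)) (ℤ.+-assoc p n (+ 1)) ⟩
    g (p +ℤ (n +ℤ + 1)) + g (p +ℤ n) ∎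

  weightedFibProductSum-cleared : ∀ {G H : ℤ → Carrier} → IsGenFib G → IsGenFib H → ∀ p q n x →
    ((1# + x) * charPoly x) * sumTo n (λ k → pow x k * G (p +ℤ + k) * H (q +ℤ + k))
      ≈ (1# + x) * (pow x (suc n) * (x * G (p +ℤ + n) * H (q +ℤ + n) - G (p +ℤ + suc n) * H (q +ℤ + suc n))
                    + G p * H q - x * G (p -ℤ + 1) * H (q -ℤ + 1))
        + x * (pow (- 1#) (suc n) * pow x (suc n) - 1#)
            * (3# * G p * H q - G (p -ℤ + 1) * H (q -ℤ + 1) - G (p +ℤ + 1) * H (q +ℤ + 1))
  weightedFibProductSum-cleared {G} {H} fibG fibH p q n x = begin
    ((1# + x) * charPoly x) * sumTo n (λ k → pow x k * G (p +ℤ + k) * H (q +ℤ + k))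
      ≈⟨ *-congˡ (sumTo-cong n (λ k → *-assoc _ _ _)) ⟩
    ((1# + x) * charPoly x) * sumTo n (λ k → pow x k * w (+ k))
      ≈⟨ *-assoc _ _ _ ⟩
    (1# + x) * (charPoly x * sumTo n (λ k → pow x k * w (+ k)))
      ≈⟨ *-congˡ (weightedSum-telescope w x n) ⟩
    (1# + x) * (boundary - sumTo n (λ k → pow x (suc k) * defect w (+ k)))
      ≈⟨ *-congˡ (+-congˡ (-‿cong (sumTo-cong n (λ k → *-congˡ (defect-product-alternates fibg fibh k))))) ⟩
    (1# + x) * (boundary - sumTo n (λ k → pow x (suc k) * (pow (- 1#) k * δ)))
      ≈⟨ x[y-z]≈xy-xz (1# + x) boundary _ ⟩
    (1# + x) * boundary - (1# + x) * sumTo n (λ k → pow x (suc k) * (pow (- 1#) k * δ))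
      ≈⟨ +-congˡ (-‿cong (alternatingGeometricSum x δ n)) ⟩
    (1# + x) * boundary - x * (1# - s * y) * δ
      ≈⟨ +-cong (*-congˡ (+-congʳ (+-congˡ w₀≈))) (-‿cong (*-congˡ (+-congʳ (+-congʳ (*-congˡ w₀≈))))) ⟩
    (1# + x) * (y * (x * w (+ n) - w (+ suc n)) + G p * H q - x * w -[1+ 0 ])
      - x * (1# - s * y) * (3# * (G p * H q) - w -[1+ 0 ] - w (+ 1))
      ≈⟨ solve 11 (λ x y s a b e g₀ h₀ g₋ h₋ t →
           (con (+ 1) :+ x) :* (y :* (x :* (a :* b) :- e) :+ g₀ :* h₀ :- x :* (g₋ :* h₋))
             :- x :* (con (+ 1) :- s :* y) :* (con (+ 3) :* (g₀ :* h₀) :- g₋ :* h₋ :- t)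
           := (con (+ 1) :+ x) :* (y :* (x :* a :* b :- e) :+ g₀ :* h₀ :- x :* g₋ :* h₋)
             :+ x :* (s :* y :- con (+ 1)) :* (con (+ 3) :* g₀ :* h₀ :- g₋ :* h₋ :- t))
           refl x y s (G (p +ℤ + n)) (H (q +ℤ + n)) (w (+ suc n)) (G p) (H q)
                (G (p -ℤ + 1)) (H (q -ℤ + 1)) (w (+ 1)) ⟩
    (1# + x) * (y * (x * G (p +ℤ + n) * H (q +ℤ + n) - G (p +ℤ + suc n) * H (q +ℤ + suc n))
                + G p * H q - x * G (p -ℤ + 1) * H (q -ℤ + 1))
      + x * (s * y - 1#) * (3# * G p * H q - G (p -ℤ + 1) * H (q -ℤ + 1) - G (p +ℤ + 1) * H (q +ℤ + 1)) ∎
    where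
    g h w : ℤ → Carrier
    g r = G (p +ℤ r)
    h r = H (q +ℤ r)
    w r = g r * h r
    fibg : IsGenFib g
    fibg = genFib-shift fibG p
    fibh : IsGenFib h
    fibh = genFib-shift fibH q
    y s δ boundary : Carrier
    y = pow x (suc n)
    s = pow (- 1#) (suc n)
    δ = defect w (+ 0)
    boundary = y * (x * w (+ n) - w (+ suc n)) + w (+ 0) - x * w -[1+ 0 ]
    w₀≈ : w (+ 0) ≈ G p * H q
    w₀≈ = reflexive (≡.cong₂ (λ i j → G i * H j) (ℤ.+-identityʳ p) (ℤ.+-identityʳ q))

open FibonacciSums using (weightedFibProductSum-cleared)
open FieldProperties using (partialFractions; 1+x≉0)

mainTheorem5 : ∀ {c ℓ : Level} (F : Field c ℓ) →
    let open Field F in let open FieldOps F in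
    (G H : ℤ → Carrier) → IsGenFib G → IsGenFib H →
    (p q : ℤ) (n : ℕ) (x : Carrier) →
    ¬ (x ≈ - 1#) →
    ¬ (1# - 3# * x + x * x ≈ 0#) →
    sumTo n (λ k → pow x k * G (p +ℤ + k) * H (q +ℤ + k))
      ≈ (1# - 3# * x + x * x) ⁻¹
          * (pow x (suc n) * (x * G (p +ℤ + n) * H (q +ℤ + n) - G (p +ℤ + suc n) * H (q +ℤ + suc n))
             + G p * H q - x * G (p -ℤ + 1) * H (q -ℤ + 1))
        + x * (pow (- 1#) (suc n) * pow x (suc n) - 1#) * ((1# + x) * (1# - 3# * x + x * x)) ⁻¹
          * (3# * G p * H q - G (p -ℤ + 1) * H (q -ℤ + 1) - G (p +ℤ + 1) * H (q +ℤ + 1))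
mainTheorem5 F G H fibG fibH p q n x x≉-1 charPoly≉0 =
  partialFractions F (1+x≉0 F x≉-1) charPoly≉0 (weightedFibProductSum-cleared F fibG fibH p q n x)
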